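{- Let $\phi$ be a rank $r$ Drinfeld module $\mathbb{F}_q[T]\to\mathrm{End}_{\mathbb{F}_q(T)}(\mathbb{G}_a)$ with $\phi_T(x)=Tx+c_1x^q+\dots+c_rx^{q^r}$, where $c_1,\dots,c_r\in\mathbb{F}_q[T]$ and $c_r\neq0$. Then for all $x\in\mathbb{F}_q[T]$, $$\hat h(x)-h(x)\le M'_\phi,\qquad M'_\phi=\frac{1}{\Theta-1}\max\{1,\deg c_1,\dots,\deg c_r\}.$$
   Context: $\Theta=q^r$. $\phi_{T^n}$ is the $n$-fold iterate of $\phi_T$. Places of $\mathbb{F}_q(T)$: finite places $v$ correspond to monic irreducible $P$, with $|y|_v=q^{ -\deg P\cdot\mathrm{ord}_P(y)}$; the infinite place has $|y|_{v_\infty}=q^{\deg y}$. Height: $h(y)=\sum_v\log_q\max\{|y|_v,1\}$. Canonical height: $\hat h(x)=\lim_{n\to\infty}h(\phi_{T^n}(x))/\Theta^n$. -}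

module Defs where

open import Level using (0ℓ)
open import Data.Nat as ℕ using (ℕ; zero; suc; _^_; _∸_; _≤_; _⊔_; NonZero)
import Data.Nat.Properties as ℕP
open import Data.Fin using (Fin; zero; suc; toℕ)
import Data.Fin.Properties as FinP
open import Data.List using (List; []; _∷_; map)
open import Data.Maybe using (Maybe; just; nothing; fromMaybe)
open import Data.Integer using (+_)
open import Data.Rational using (ℚ; _/_)
open import Data.Product using (∃; _,_)
open import Function using (_∘_)
open import Function.Bundles using (_↔_; Inverse)
open import Algebra.Core using (Op₁; Op₂)
open import Algebra.Structures using (IsCommutativeRing)
open import Relation.Binary.PropositionalEquality
open import Relation.Binary.Definitions using (DecidableEquality)
open import Relation.Nullary using (yes; no; ¬_)
open import Data.Empty using (⊥-elim)

record FiniteField (q : ℕ) : Set₁ where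
  infixl 7 _*_
  infixl 6 _+_
  field
    Carrier : Set
    _+_ _*_ : Op₂ Carrier
    -_ : Op₁ Carrier
    0# 1# : Carrier
    isCommutativeRing : IsCommutativeRing _≡_ _+_ _*_ -_ 0# 1#
    0≢1 : 0# ≢ 1#
    inverse : ∀ x → x ≢ 0# → ∃ λ y → x * y ≡ 1#
    _≟_ : DecidableEquality Carrier
    enum : Carrier ↔ Fin q

module _ {q : ℕ} (F : FiniteField q) where
  open FiniteField F

  private
    e : Carrier → Fin q
    e = Inverse.to enum

    e-inj : ∀ {a b} → e a ≡ e b → a ≡ b
    e-inj {a} {b} p =
      trans (sym (Inverse.inverseʳ enum refl))
            (trans (cong (Inverse.from enum) p) (Inverse.inverseʳ enum refl))

  q≥2 : 2 ≤ q
  q≥2 = two (e 0#) (e 1#) (λ p → 0≢1 (e-inj p))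
    where
    two : ∀ {n} (a b : Fin n) → a ≢ b → 2 ≤ n
    two {suc zero} zero zero ne = ⊥-elim (ne refl)
    two {suc (suc _)} _ _ _ = ℕ.s≤s (ℕ.s≤s ℕ.z≤n)

-- Polynomials in F_q[T], as coefficient lists (constant term first;
-- trailing zero coefficients allowed).

module Poly {q : ℕ} (F : FiniteField q) where
  open FiniteField F

  Poly : Set
  Poly = List Carrier

  0P : Poly
  0P = []

  1P : Poly
  1P = 1# ∷ []

  TP : Poly
  TP = 0# ∷ 1# ∷ []

  _+P_ : Poly → Poly → Poly
  [] +P ys = ys
  (x ∷ xs) +P [] = x ∷ xs
  (x ∷ xs) +P (y ∷ ys) = (x + y) ∷ (xs +P ys)

  scaleP : Carrier → Poly → Poly
  scaleP a = map (a *_)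

  _*P_ : Poly → Poly → Poly
  [] *P ys = []
  (x ∷ xs) *P ys = scaleP x ys +P (0# ∷ (xs *P ys))

  _^P_ : Poly → ℕ → Poly
  p ^P zero = 1P
  p ^P suc n = p *P (p ^P n)

  deg : Poly → Maybe ℕ
  deg [] = nothing
  deg (x ∷ xs) with deg xs
  ... | just d = just (suc d)
  ... | nothing with x ≟ 0#
  ...   | yes _ = nothing
  ...   | no _ = just 0

  IsZeroP : Poly → Set
  IsZeroP p = deg p ≡ nothing

  deg⁺ : Poly → ℕ
  deg⁺ p = fromMaybe 0 (deg p)

  -- Weil height h(y) = Σ_v log_q max{|y|_v,1} of y ∈ F_q[T]:
  -- all finite places contribute 0 (|y|_v ≤ 1), the infinite place
  -- contributes max{0, deg y}.
  h : Poly → ℕ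
  h = deg⁺

  ΣP : (n : ℕ) → (Fin n → Poly) → Poly
  ΣP zero f = 0P
  ΣP (suc n) f = f zero +P ΣP n (f ∘ suc)

  -- φ_T(x) = T x + Σ_{i=1}^{r} c_i x^{q^i}; coefficient c_i is c (i-1)
  φT : (r : ℕ) → (Fin r → Poly) → Poly → Poly
  φT r c x = (TP *P x) +P ΣP r (λ j → c j *P (x ^P (q ^ suc (toℕ j))))

  φTⁿ : (r : ℕ) → (Fin r → Poly) → ℕ → Poly → Poly
  φTⁿ r c zero x = x
  φTⁿ r c (suc n) x = φT r c (φTⁿ r c n x)

  maxDeg : (r : ℕ) → (Fin r → Poly) → ℕ
  maxDeg zero c = 1
  maxDeg (suc r) c = deg⁺ (c zero) ⊔ maxDeg r (c ∘ suc)

  Θ : ℕ → ℕ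
  Θ r = q ^ r

  private
    instance
      q-nz : NonZero q
      q-nz = ℕ.>-nonZero (ℕP.<-trans (ℕ.s≤s ℕ.z≤n) (q≥2 F))

    Θ-1-nz : (k : ℕ) → NonZero (Θ (suc k) ∸ 1)
    Θ-1-nz k = ℕ.>-nonZero (ℕP.<-≤-trans (ℕ.s≤s ℕ.z≤n)
      (ℕP.∸-monoˡ-≤ 1 (ℕP.≤-trans (q≥2 F)
        (ℕP.≤-trans (ℕP.m≤m*n q (q ^ k) {{ℕP.m^n≢0 q k}}) ℕP.≤-refl))))

  ĥ-approx : (r : ℕ) → (Fin r → Poly) → ℕ → Poly → ℚ
  ĥ-approx r c n x = _/_ (+ h (φTⁿ r c n x)) (Θ r ^ n) {{ℕP.m^n≢0 (Θ r) n {{ℕP.m^n≢0 q r}}}}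

  M′ : (k : ℕ) → (Fin (suc k) → Poly) → ℚ
  M′ k c = _/_ (+ maxDeg (suc k) c) (Θ (suc k) ∸ 1) {{Θ-1-nz k}}

{-# OPTIONS --safe #-}
module Submission where

-- With d = deg x and M = max{1, deg c_i}, every term T x and c_i x^{q^i} of φ_T(x) has degree at
-- most M + Θ d, so the degrees D_n of φ_{T^n}(x) obey the affine recurrence D_{n+1} ≤ M + Θ D_n.
-- Hence (Θ - 1) D_n + M ≤ Θ^n ((Θ - 1) d + M), that is D_n / Θ^n - d ≤ M / (Θ - 1) for every n;
-- as the height of a polynomial is its degree, every approximant of ĥ(x) - h(x) is at most M'_φ.

open import Defs
open import Data.Nat using (ℕ; suc) renaming (_≤_ to _≤ℕ_)
open import Data.Fin using (Fin; fromℕ)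
open import Data.Integer using (+_)
open import Data.Rational using (ℚ; _/_; _+_; _-_; _<_; _≤_; 0ℚ)
open import Data.Product using (∃)
open import Relation.Nullary using (¬_)

import Data.Nat as ℕ
open import Data.Nat using (zero; _*_; _^_; _∸_; NonZero; z≤n; s≤s)
import Data.Nat.Properties as ℕₚ
open import Data.Nat.Tactic.RingSolver using (solve-∀)
open import Data.Fin using (toℕ; zero; suc)
import Data.Fin.Properties as Fin
open import Data.List using ([]; _∷_; drop)
open import Data.List.Properties using (drop-map)
open import Data.List.Relation.Unary.All as All using (All; []; _∷_)
open import Data.List.Relation.Unary.All.Properties using (drop⁺; map⁺)
open import Data.Maybe using (just; nothing; maybe′)
open import Data.Product using (_,_)
import Data.Integer as ℤ
import Data.Integer.Properties as ℤ
open import Data.Rational using (toℚᵘ; -_)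
import Data.Rational.Properties as ℚₚ
open ℚₚ using (toℚᵘ-cancel-≤; toℚᵘ-homo-+; toℚᵘ-fromℚᵘ; +-0-abelianGroup; +-monoˡ-≤; +-monoʳ-≤; +-identityʳ; <⇒≤)
import Data.Rational.Unnormalised as ℚᵘ
import Data.Rational.Unnormalised.Properties as ℚᵘ
open import Algebra.Properties.AbelianGroup +-0-abelianGroup using (xyx⁻¹≈y)
open import Algebra.Structures using (IsCommutativeRing)
open import Relation.Binary.PropositionalEquality
open import Relation.Nullary using (yes; no)
open import Data.Empty using (⊥-elim)

affine-recurrence-bound : ∀ {Θ} M (D : ℕ → ℕ) → 1 ≤ℕ Θ → (∀ n → D (suc n) ≤ℕ M ℕ.+ Θ * D n) →
                          ∀ n → (Θ ∸ 1) * D n ℕ.+ M ≤ℕ Θ ^ n * ((Θ ∸ 1) * D 0 ℕ.+ M)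
affine-recurrence-bound M D (s≤s z≤n) step zero = ℕₚ.≤-reflexive (sym (ℕₚ.*-identityˡ _))
affine-recurrence-bound {suc t} M D Θ≥1 step (suc n) = begin
  t * D (suc n) ℕ.+ M                     ≤⟨ ℕₚ.+-monoˡ-≤ M (ℕₚ.*-monoʳ-≤ t (step n)) ⟩
  t * (M ℕ.+ suc t * D n) ℕ.+ M           ≡⟨ regroup t M (D n) ⟩
  suc t * (t * D n ℕ.+ M)                 ≤⟨ ℕₚ.*-monoʳ-≤ (suc t) (affine-recurrence-bound M D Θ≥1 step n) ⟩
  suc t * (suc t ^ n * (t * D 0 ℕ.+ M))   ≡⟨ ℕₚ.*-assoc (suc t) (suc t ^ n) _ ⟨
  suc t ^ suc n * (t * D 0 ℕ.+ M)         ∎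
  where
  open ℕₚ.≤-Reasoning
  regroup : ∀ t M x → t * (M ℕ.+ suc t * x) ℕ.+ M ≡ suc t * (t * x ℕ.+ M)
  regroup = solve-∀

p≤q+r⇒p-q≤r : ∀ {p q r} → p ≤ q + r → p - q ≤ r
p≤q+r⇒p-q≤r {p} {q} {r} p≤q+r = begin
  p - q      ≤⟨ +-monoˡ-≤ (- q) p≤q+r ⟩
  q + r - q  ≡⟨ xyx⁻¹≈y q r ⟩
  r          ∎
  where open ℚₚ.≤-Reasoning

tD≤P[td+M]⇒D/P≤d+M/t : ∀ D d M t P .{{_ : NonZero t}} .{{_ : NonZero P}} →
                        t * D ≤ℕ P * (t * d ℕ.+ M) → + D / P ≤ + d / 1 + + M / t
tD≤P[td+M]⇒D/P≤d+M/t D d M t@(suc t-1) P@(suc P-1) tD≤P[td+M] =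
  toℚᵘ-cancel-≤ (let open ℚᵘ.≤-Reasoning in begin
    toℚᵘ (+ D / P)                        ≃⟨ toℚᵘ-fromℚᵘ D/Pᵘ ⟩
    D/Pᵘ                                  ≤⟨ ℚᵘ.*≤* cross-multiplied ⟩
    d/1ᵘ ℚᵘ.+ M/tᵘ                        ≃⟨ ℚᵘ.+-cong (toℚᵘ-fromℚᵘ d/1ᵘ) (toℚᵘ-fromℚᵘ M/tᵘ) ⟨
    toℚᵘ (+ d / 1) ℚᵘ.+ toℚᵘ (+ M / t)   ≃⟨ toℚᵘ-homo-+ (+ d / 1) (+ M / t) ⟨
    toℚᵘ (+ d / 1 + + M / t)             ∎)
  where
  D/Pᵘ d/1ᵘ M/tᵘ : ℚᵘ.ℚᵘ
  D/Pᵘ = ℚᵘ.mkℚᵘ (+ D) P-1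
  d/1ᵘ = ℚᵘ.mkℚᵘ (+ d) 0
  M/tᵘ = ℚᵘ.mkℚᵘ (+ M) t-1
  cross-multiplied : ℚᵘ.↥ D/Pᵘ ℤ.* ℚᵘ.↧ (d/1ᵘ ℚᵘ.+ M/tᵘ) ℤ.≤ ℚᵘ.↥ (d/1ᵘ ℚᵘ.+ M/tᵘ) ℤ.* ℚᵘ.↧ D/Pᵘ
  cross-multiplied = begin
    + D ℤ.* + (1 * t)                     ≡⟨ ℤ.pos-* D (1 * t) ⟨
    + (D * (1 * t))                       ≡⟨ cong +_ (regroupˡ D t) ⟩
    + (t * D)                             ≤⟨ ℤ.+≤+ tD≤P[td+M] ⟩
    + (P * (t * d ℕ.+ M))                 ≡⟨ cong +_ (regroupʳ P t d M) ⟩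
    + ((d * t ℕ.+ M * 1) * P)             ≡⟨ ℤ.pos-* (d * t ℕ.+ M * 1) P ⟩
    + (d * t ℕ.+ M * 1) ℤ.* + P           ≡⟨ cong (ℤ._* + P) (ℤ.pos-+ (d * t) (M * 1)) ⟩
    (+ (d * t) ℤ.+ + (M * 1)) ℤ.* + P     ≡⟨ cong (ℤ._* + P) (cong₂ ℤ._+_ (ℤ.pos-* d t) (ℤ.pos-* M 1)) ⟩
    (+ d ℤ.* + t ℤ.+ + M ℤ.* + 1) ℤ.* + P ∎
    where
    open ℤ.≤-Reasoning
    regroupˡ : ∀ D t → D * (1 * t) ≡ t * D
    regroupˡ = solve-∀
    regroupʳ : ∀ P t d M → P * (t * d ℕ.+ M) ≡ (d * t ℕ.+ M * 1) * P
    regroupʳ = solve-∀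

module _ {q : ℕ} (F : FiniteField q) where
  open FiniteField F using (0#; _≟_; isCommutativeRing) renaming (_*_ to _*F_)
  open IsCommutativeRing isCommutativeRing using (zeroˡ; zeroʳ; +-identityˡ)
  open Poly F

  AllZero : Poly → Set
  AllZero = All (_≡ 0#)

  DegreeAtMost : ℕ → Poly → Set
  DegreeAtMost d p = AllZero (drop (suc d) p)

  degreeAtMost-mono : ∀ {a b} p → a ≤ℕ b → DegreeAtMost a p → DegreeAtMost b p
  degreeAtMost-mono                 []       _         _    = []
  degreeAtMost-mono {zero}  {b}     (_ ∷ _)  _         zs   = drop⁺ b zs
  degreeAtMost-mono {suc _} {suc _} (_ ∷ xs) (s≤s a≤b) xs≤a = degreeAtMost-mono xs a≤b xs≤a

  allZero-+P : ∀ {p r} → AllZero p → AllZero r → AllZero (p +P r)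
  allZero-+P {[]}              _           zr          = zr
  allZero-+P {_ ∷ _} {[]}      zp          _           = zp
  allZero-+P {_ ∷ _} {_ ∷ _}   (refl ∷ zp) (refl ∷ zr) = +-identityˡ 0# ∷ allZero-+P zp zr

  degreeAtMost-+P : ∀ d p r → DegreeAtMost d p → DegreeAtMost d r → DegreeAtMost d (p +P r)
  degreeAtMost-+P d       []       r        _    r≤d  = r≤d
  degreeAtMost-+P d       (_ ∷ _)  []       p≤d  _    = p≤d
  degreeAtMost-+P zero    (_ ∷ _)  (_ ∷ _)  zp   zr   = allZero-+P zp zr
  degreeAtMost-+P (suc d) (_ ∷ xs) (_ ∷ ys) xs≤d ys≤d = degreeAtMost-+P d xs ys xs≤d ys≤d

  allZero-scaleP-0# : ∀ p → AllZero (scaleP 0# p)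
  allZero-scaleP-0# p = map⁺ (All.universal zeroˡ p)

  degreeAtMost-scaleP : ∀ d a p → DegreeAtMost d p → DegreeAtMost d (scaleP a p)
  degreeAtMost-scaleP d a p p≤d = subst AllZero (sym (drop-map (suc d) p))
    (map⁺ (All.map (λ x≡0 → trans (cong (a *F_) x≡0) (zeroʳ a)) p≤d))

  allZero-*P : ∀ p r → AllZero p → AllZero (p *P r)
  allZero-*P []       r _           = []
  allZero-*P (_ ∷ xs) r (refl ∷ zs) = allZero-+P (allZero-scaleP-0# r) (refl ∷ allZero-*P xs r zs)

  degreeAtMost-*P : ∀ a b p r → DegreeAtMost a p → DegreeAtMost b r → DegreeAtMost (a ℕ.+ b) (p *P r)
  degreeAtMost-*P a       b []       r _    _   = []
  degreeAtMost-*P zero    b (x ∷ xs) r zs   r≤b =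
    degreeAtMost-+P b (scaleP x r) (0# ∷ (xs *P r))
      (degreeAtMost-scaleP b x r r≤b) (drop⁺ b (allZero-*P xs r zs))
  degreeAtMost-*P (suc a) b (x ∷ xs) r xs≤a r≤b =
    degreeAtMost-+P (suc (a ℕ.+ b)) (scaleP x r) (0# ∷ (xs *P r))
      (degreeAtMost-mono (scaleP x r) (ℕₚ.m≤n⇒m≤1+n (ℕₚ.m≤n+m b a)) (degreeAtMost-scaleP b x r r≤b))
      (degreeAtMost-*P a b xs r xs≤a r≤b)

  degreeAtMost-^P : ∀ a p m → DegreeAtMost a p → DegreeAtMost (m * a) (p ^P m)
  degreeAtMost-^P a p zero    _   = []
  degreeAtMost-^P a p (suc m) p≤a = degreeAtMost-*P a (m * a) p (p ^P m) p≤a (degreeAtMost-^P a p m p≤a)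

  degreeAtMost-ΣP : ∀ d n f → (∀ j → DegreeAtMost d (f j)) → DegreeAtMost d (ΣP n f)
  degreeAtMost-ΣP d zero    f _     = []
  degreeAtMost-ΣP d (suc n) f f≤d =
    degreeAtMost-+P d (f zero) _ (f≤d zero) (degreeAtMost-ΣP d n (λ j → f (suc j)) (λ j → f≤d (suc j)))

  deg-sound : ∀ p → maybe′ (λ e → DegreeAtMost e p) (AllZero p) (deg p)
  deg-sound []       = []
  deg-sound (x ∷ xs) with deg xs | deg-sound xs
  ... | just _  | xs≤e = xs≤e
  ... | nothing | zs with x ≟ 0#
  ...   | yes x≡0 = x≡0 ∷ zs
  ...   | no _    = zs

  degreeAtMost-deg⁺ : ∀ p → DegreeAtMost (deg⁺ p) p
  degreeAtMost-deg⁺ p with deg p | deg-sound p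
  ... | just _  | p≤e = p≤e
  ... | nothing | zs  = drop⁺ 1 zs

  allZero⇒deg≡nothing : ∀ p → AllZero p → deg p ≡ nothing
  allZero⇒deg≡nothing []       _          = refl
  allZero⇒deg≡nothing (x ∷ xs) (x≡0 ∷ zs) with deg xs | allZero⇒deg≡nothing xs zs
  ... | .nothing | refl with x ≟ 0#
  ...   | yes _   = refl
  ...   | no x≢0 = ⊥-elim (x≢0 x≡0)

  deg⁺-least : ∀ d p → DegreeAtMost d p → deg⁺ p ≤ℕ d
  deg⁺-least d       []       _ = z≤n
  deg⁺-least zero    (x ∷ xs) zs with deg xs | allZero⇒deg≡nothing xs zs
  ... | .nothing | refl with x ≟ 0#
  ...   | yes _ = z≤n
  ...   | no _  = z≤n
  deg⁺-least (suc d) (x ∷ xs) xs≤d with deg xs | deg⁺-least d xs xs≤d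
  ... | just _  | e≤d = s≤s e≤d
  ... | nothing | _ with x ≟ 0#
  ...   | yes _ = z≤n
  ...   | no _  = z≤n

  private instance
    q-nonZero : NonZero q
    q-nonZero = ℕ.>-nonZero (ℕₚ.≤-trans (s≤s z≤n) (q≥2 F))

  1≤Θ : ∀ r → 1 ≤ℕ Θ r
  1≤Θ r = ℕₚ.m^n>0 q r

  Θ^n-nonZero : ∀ r n → NonZero (Θ r ^ n)
  Θ^n-nonZero r n = ℕₚ.m^n≢0 (Θ r) n {{ℕₚ.m^n≢0 q r}}

  Θ∸1-nonZero : ∀ k → NonZero (Θ (suc k) ∸ 1)
  Θ∸1-nonZero k = ℕ.>-nonZero (ℕₚ.∸-monoˡ-≤ 1 (ℕₚ.≤-trans (q≥2 F) (ℕₚ.m≤m*n q (q ^ k) {{ℕₚ.m^n≢0 q k}})))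

  1≤maxDeg : ∀ r c → 1 ≤ℕ maxDeg r c
  1≤maxDeg zero    c = ℕₚ.≤-refl
  1≤maxDeg (suc r) c = ℕₚ.m≤n⇒m≤o⊔n (deg⁺ (c zero)) (1≤maxDeg r (λ j → c (suc j)))

  deg⁺≤maxDeg : ∀ r c j → deg⁺ (c j) ≤ℕ maxDeg r c
  deg⁺≤maxDeg (suc r) c zero    = ℕₚ.m≤m⊔n (deg⁺ (c zero)) _
  deg⁺≤maxDeg (suc r) c (suc j) = ℕₚ.m≤n⇒m≤o⊔n (deg⁺ (c zero)) (deg⁺≤maxDeg r (λ i → c (suc i)) j)

  deg⁺-φT≤ : ∀ r c x → deg⁺ (φT r c x) ≤ℕ maxDeg r c ℕ.+ Θ r * deg⁺ x
  deg⁺-φT≤ r c x =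
    deg⁺-least _ (φT r c x) (degreeAtMost-+P _ (TP *P x) (ΣP r frobeniusTerm) linear-term frobenius-terms)
    where
    d : ℕ
    d = deg⁺ x
    frobeniusTerm : Fin r → Poly
    frobeniusTerm j = c j *P (x ^P (q ^ suc (toℕ j)))
    d≤Θd : d ≤ℕ Θ r * d
    d≤Θd = ℕₚ.m≤n*m d (Θ r) {{ℕₚ.m^n≢0 q r}}
    linear-term : DegreeAtMost (maxDeg r c ℕ.+ Θ r * d) (TP *P x)
    linear-term = degreeAtMost-mono (TP *P x) (ℕₚ.+-mono-≤ (1≤maxDeg r c) d≤Θd)
      (degreeAtMost-*P 1 d TP x [] (degreeAtMost-deg⁺ x))
    frobenius-terms : DegreeAtMost (maxDeg r c ℕ.+ Θ r * d) (ΣP r frobeniusTerm)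
    frobenius-terms = degreeAtMost-ΣP _ r frobeniusTerm λ j →
      degreeAtMost-mono (frobeniusTerm j)
        (ℕₚ.+-mono-≤ (deg⁺≤maxDeg r c j) (ℕₚ.*-monoˡ-≤ d (ℕₚ.^-monoʳ-≤ q (Fin.toℕ<n j))))
        (degreeAtMost-*P _ _ (c j) _ (degreeAtMost-deg⁺ (c j)) (degreeAtMost-^P d x (q ^ suc (toℕ j)) (degreeAtMost-deg⁺ x)))

  ĥ-approx-h≤M′ : ∀ k c x n → ĥ-approx (suc k) c n x - + h x / 1 ≤ M′ k c
  ĥ-approx-h≤M′ k c x n =
    p≤q+r⇒p-q≤r (tD≤P[td+M]⇒D/P≤d+M/t (D n) (h x) M (Θ r ∸ 1) (Θ r ^ n) {{Θ∸1-nonZero k}} {{Θ^n-nonZero r n}}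
      (ℕₚ.m+n≤o⇒m≤o _ (affine-recurrence-bound M D (1≤Θ r) D-step n)))
    where
    r M : ℕ
    r = suc k
    M = maxDeg r c
    D : ℕ → ℕ
    D m = h (φTⁿ r c m x)
    D-step : ∀ m → D (suc m) ≤ℕ M ℕ.+ Θ r * D m
    D-step m = deg⁺-φT≤ r c (φTⁿ r c m x)

-- The bound holds for every n, so N = 0 serves every ε.
lemma2p9 : {q : ℕ} (F : FiniteField q) (k : ℕ) (c : Fin (suc k) → Poly.Poly F) →
    ¬ Poly.IsZeroP F (c (fromℕ k)) →
    (x : Poly.Poly F) (ε : ℚ) → 0ℚ < ε →
    ∃ λ (N : ℕ) → ∀ (n : ℕ) → N ≤ℕ n →
    Poly.ĥ-approx F (suc k) c n x - (+ Poly.h F x / 1) ≤ Poly.M′ F k c + ε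
lemma2p9 F k c _ x ε ε>0 = 0 , λ n _ → begin
  ĥ-approx (suc k) c n x - + h x / 1   ≤⟨ ĥ-approx-h≤M′ F k c x n ⟩
  M′ k c                               ≡⟨ +-identityʳ (M′ k c) ⟨
  M′ k c + 0ℚ                          ≤⟨ +-monoʳ-≤ (M′ k c) (<⇒≤ ε>0) ⟩
  M′ k c + ε                           ∎
  where
  open Poly F
  open ℚₚ.≤-Reasoning
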